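{- Let $f$ be a morphism of $\mathrm{Mat}_{\mathbb N}$ and let $f=f_1\otimes\cdots\otimes f_k$ ($k\ge 1$) be its $\otimes$-decomposition into morphisms $f_i$ that are not $\otimes$-decomposable, and let $r_i=\mathrm{rank}(f_i)$. Then \[\max\{r_1,\dots,r_k\}\le\mathrm{mwd}(f)\le\max\{r_1,\dots,r_k\}+1.\]
   Context: $\mathrm{Mat}_{\mathbb N}$ is the prop (strict symmetric monoidal category with objects the natural numbers and $m\otimes n=m+n$) whose morphisms $n\to m$ are $m\times n$ matrices with entries in $\mathbb N$; the composite of $A\colon n\to k$ followed by $B\colon k\to m$ is the product $B\cdot A$, and $A\otimes B=\begin{pmatrix}A&0\\0&B\end{pmatrix}$. A morphism $f$ is $\otimes$-decomposable if there are $f_1,f_2$, both distinct from $f$, with $f=f_1\otimes f_2$. The rank of $A\in\mathrm{Mat}_{\mathbb N}(m,n)$ is $\mathrm{rank}(A)=\min\{k: A=C\cdot B,\ B\in\mathrm{Mat}_{\mathbb N}(k,n),\ C\in\mathrm{Mat}_{\mathbb N}(m,k)\}$. Atoms: $\mathrm{cp}_1=\begin{pmatrix}1\\1\end{pmatrix}\colon1\to2$, $\mathrm{del}_1\colon1\to0$ (the $0\times1$ matrix), $\mathrm{add}_1=(1\ 1)\colon2\to1$, $\mathrm{zero}_1\colon0\to1$ (the $1\times0$ matrix), the symmetry $\sigma_{1,1}=\begin{pmatrix}0&1\\1&0\end{pmatrix}$ and $\mathrm{id}_1=(1)$. Weights: $w(n)=n$ for objects, $w(g)=\max\{m,n\}$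 for an atom $g\colon n\to m$. Monoidal width: monoidal decompositions $D(f)$ of $f\colon a\to b$ are: a leaf $(f)$ if $f$ is an atom; $(d_1\otimes d_2)$ with $d_i\in D(f_i)$ and $f=f_1\otimes f_2$; $(d_1;_jd_2)$ with $d_1\in D(f_1\colon a\to j)$, $d_2\in D(f_2\colon j\to b)$ and $f$ the composite of $f_1$ followed by $f_2$. Width: $\mathrm{wd}((f))=w(f)$, $\mathrm{wd}(d_1\otimes d_2)=\max\{\mathrm{wd}(d_1),\mathrm{wd}(d_2)\}$, $\mathrm{wd}(d_1;_jd_2)=\max\{\mathrm{wd}(d_1),j,\mathrm{wd}(d_2)\}$; $\mathrm{mwd}(f)=\min_{d\in D(f)}\mathrm{wd}(d)$. -}

module Defs where

open import Data.Nat using (ℕ; zero; suc; _+_; _*_; _⊔_; _≤_)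
open import Data.Fin using (Fin)
open import Data.Vec using (Vec; []; _∷_; map; tabulate; lookup; zipWith; sum; _++_; replicate)
open import Data.Product using (Σ; _×_; _,_)
open import Relation.Binary.PropositionalEquality using (_≡_; _≢_)
open import Relation.Nullary using (¬_)

-- An m×n matrix over ℕ, stored as m rows of length n.
-- A morphism n → m of Mat_ℕ is an element of Mat m n.
Mat : ℕ → ℕ → Set
Mat m n = Vec (Vec ℕ n) m

-- Matrix product: (B · A) for A : n → k and B : k → m is the composite "A then B".
_·_ : ∀ {m k n} → Mat m k → Mat k n → Mat m n
B · A = map (λ row → tabulate (λ j → sum (zipWith _*_ row (map (λ r → lookup r j) A)))) B

_⊗_ : ∀ {m₁ n₁ m₂ n₂} → Mat m₁ n₁ → Mat m₂ n₂ → Mat (m₁ + m₂) (n₁ + n₂)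
_⊗_ {n₁ = n₁} {n₂ = n₂} A B =
  map (λ r → r ++ replicate n₂ 0) A ++ map (λ r → replicate n₁ 0 ++ r) B

record Mor : Set where
  constructor mor
  field
    dom : ℕ
    cod : ℕ
    mat : Mat cod dom
open Mor public

_⊗ₘ_ : Mor → Mor → Mor
mor n₁ m₁ A ⊗ₘ mor n₂ m₂ B = mor (n₁ + n₂) (m₁ + m₂) (A ⊗ B)

Decomposable : Mor → Set
Decomposable f = Σ Mor (λ f₁ → Σ Mor (λ f₂ → f₁ ≢ f × f₂ ≢ f × f ≡ f₁ ⊗ₘ f₂))

FactorsThrough : Mor → ℕ → Set
FactorsThrough f k = Σ (Mat k (dom f)) (λ B → Σ (Mat (cod f) k) (λ C → mat f ≡ C · B))

IsRank : Mor → ℕ → Set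
IsRank f r = FactorsThrough f r × (∀ k → FactorsThrough f k → r ≤ k)

data Atom : (n m : ℕ) → Mat m n → Set where
  cp₁   : Atom 1 2 ((1 ∷ []) ∷ (1 ∷ []) ∷ [])
  del₁  : Atom 1 0 []
  add₁  : Atom 2 1 ((1 ∷ 1 ∷ []) ∷ [])
  zero₁ : Atom 0 1 ([] ∷ [])
  σ₁₁   : Atom 2 2 ((0 ∷ 1 ∷ []) ∷ (1 ∷ 0 ∷ []) ∷ [])
  id₁   : Atom 1 1 ((1 ∷ []) ∷ [])

data D : (n m : ℕ) → Mat m n → Set where
  leaf : ∀ {n m f} → Atom n m f → D n m f
  tens : ∀ {n₁ m₁ n₂ m₂} {f₁ : Mat m₁ n₁} {f₂ : Mat m₂ n₂} →
         D n₁ m₁ f₁ → D n₂ m₂ f₂ → D (n₁ + n₂) (m₁ + m₂) (f₁ ⊗ f₂)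
  seq  : ∀ {n j m} {f₁ : Mat j n} {f₂ : Mat m j} →
         D n j f₁ → D j m f₂ → D n m (f₂ · f₁)

wd : ∀ {n m f} → D n m f → ℕ
wd (leaf {n} {m} _) = n ⊔ m
wd (tens d₁ d₂) = wd d₁ ⊔ wd d₂
wd (seq {j = j} d₁ d₂) = wd d₁ ⊔ j ⊔ wd d₂

DMor : Mor → Set
DMor f = D (dom f) (cod f) (mat f)

-- Both bounds rest on submatrices, i.e. matrices obtained by deleting rows and columns.
--
-- Lower bound: by induction on a monoidal decomposition d of F, every ⊗-indecomposable
-- submatrix g of F factors through at most wd d wires. A leaf factors through its domain
-- and a composite through its middle object j; a submatrix of F₁ ⊗ F₂ is the ⊗ of a
-- submatrix of F₁ and one of F₂, so an indecomposable one is a submatrix of F₁ or of F₂.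
-- Each fᵢ is an indecomposable submatrix of f, hence rᵢ ≤ wd d.
--
-- Upper bound: A : n → m has a decomposition of width m + 1 that adds its columns, one input
-- at a time, into m accumulators, and one of width n + 1 that computes its rows one at a
-- time while keeping the n inputs. Realising B with the first and C with the second for a
-- rank factorisation fᵢ = C · B through rᵢ wires gives width rᵢ + 1 for fᵢ, and the ⊗ of
-- these decompositions has width max rᵢ + 1.

module Submission where

open import Defs
open import Data.Nat using (ℕ; zero; suc; _+_; _*_; _⊔_; _≤_; z≤n; z<s; _≟_)
open import Data.Nat.Properties
open import Data.Nat.Tactic.RingSolver using (solve-∀)
open import Data.Fin using (Fin) renaming (zero to fzero; suc to fsuc)
open import Data.Vec
  using (Vec; []; _∷_; lookup; foldr₁; map; tabulate; zipWith; sum; _++_; replicate; head; tail; take; drop)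
open import Data.Vec.Properties
  using ( ≡-dec; map-++; map-∘; map-cong; map-id; tabulate-cong; take++drop≡id
        ; ∷-injectiveˡ; ∷-injectiveʳ)
open import Data.Product using (Σ; _×_; _,_; proj₁; map₁; map₂; ∃-syntax)
open import Data.Sum using (_⊎_; inj₁; inj₂)
open import Data.Empty using (⊥-elim)
open import Function using (id; _∘_)
open import Relation.Binary.Definitions using (DecidableEquality)
open import Relation.Binary.PropositionalEquality
open import Relation.Nullary using (¬_; yes; no)
open ≡-Reasoning

-- Matrices as linear maps

map-∘-cong : ∀ {A B C : Set} {k} {f : B → C} {g : A → B} {h : A → C} →
  (∀ x → f (g x) ≡ h x) → (xs : Vec A k) → map f (map g xs) ≡ map h xs
map-∘-cong {f = f} {g} fg≗h xs = trans (sym (map-∘ f g xs)) (map-cong fg≗h xs)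

1*x+0≡x : ∀ x → 1 * x + 0 ≡ x
1*x+0≡x x = trans (+-identityʳ (1 * x)) (*-identityˡ x)

dot : ∀ {n} → Vec ℕ n → Vec ℕ n → ℕ
dot r v = sum (zipWith _*_ r v)

apply : ∀ {m n} → Mat m n → Vec ℕ n → Vec ℕ m
apply A v = map (λ r → dot r v) A

axpy : ∀ {m} → ℕ → Vec ℕ m → Vec ℕ m → Vec ℕ m
axpy x a v = zipWith _+_ (map (_* x) a) v

column : ∀ {m n} → Fin n → Mat m n → Vec ℕ m
column j A = map (λ r → lookup r j) A

dot-zeroˡ : ∀ {n} (v : Vec ℕ n) → dot (replicate n 0) v ≡ 0
dot-zeroˡ [] = refl
dot-zeroˡ (x ∷ v) = dot-zeroˡ v

dot-zeroʳ : ∀ {n} (r : Vec ℕ n) → dot r (replicate n 0) ≡ 0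
dot-zeroʳ [] = refl
dot-zeroʳ (x ∷ r) = cong₂ _+_ (*-zeroʳ x) (dot-zeroʳ r)

dot-++ : ∀ {n₁ n₂} (r₁ u : Vec ℕ n₁) (r₂ w : Vec ℕ n₂) →
  dot (r₁ ++ r₂) (u ++ w) ≡ dot r₁ u + dot r₂ w
dot-++ [] [] r₂ w = refl
dot-++ (x ∷ r₁) (y ∷ u) r₂ w =
  trans (cong (x * y +_) (dot-++ r₁ u r₂ w)) (sym (+-assoc (x * y) (dot r₁ u) (dot r₂ w)))

dot-axpy : ∀ {k} (b a v : Vec ℕ k) x → dot b (axpy x a v) ≡ dot b a * x + dot b v
dot-axpy [] [] [] x = refl
dot-axpy (β ∷ b) (α ∷ a) (y ∷ v) x = begin
  β * (α * x + y) + dot b (axpy x a v)       ≡⟨ cong (β * (α * x + y) +_) (dot-axpy b a v x) ⟩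
  β * (α * x + y) + (dot b a * x + dot b v)  ≡⟨ rearrange β α x y (dot b a) (dot b v) ⟩
  (β * α + dot b a) * x + (β * y + dot b v)  ∎
  where
  rearrange : ∀ β α x y p q → β * (α * x + y) + (p * x + q) ≡ (β * α + p) * x + (β * y + q)
  rearrange = solve-∀

apply-[] : ∀ {m} (A : Mat m 0) → apply A [] ≡ replicate m 0
apply-[] [] = refl
apply-[] ([] ∷ A) = cong (0 ∷_) (apply-[] A)

apply-∷ : ∀ {m n} (A : Mat m (suc n)) x v →
  apply A (x ∷ v) ≡ axpy x (map head A) (apply (map tail A) v)
apply-∷ [] x v = refl
apply-∷ ((α ∷ r) ∷ A) x v = cong (α * x + dot r v ∷_) (apply-∷ A x v)

column-zero : ∀ {m n} (A : Mat m (suc n)) → column fzero A ≡ map head A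
column-zero = map-cong λ { (x ∷ r) → refl }

column-suc : ∀ {m n} (j : Fin n) (A : Mat m (suc n)) → column (fsuc j) A ≡ column j (map tail A)
column-suc j A = trans (map-cong (λ { (x ∷ r) → refl }) A) (map-∘ (λ r → lookup r j) tail A)

dot-tabulate-column : ∀ {k n} (b : Vec ℕ k) (A : Mat k n) v →
  dot (tabulate (λ j → dot b (column j A))) v ≡ dot b (apply A v)
dot-tabulate-column b A [] = sym (trans (cong (dot b) (apply-[] A)) (dot-zeroʳ b))
dot-tabulate-column b A (y ∷ v) = begin
  dot b (column fzero A) * y + dot (tabulate (λ j → dot b (column (fsuc j) A))) v
    ≡⟨ cong₂ (λ c t → dot b c * y + dot t v)
             (column-zero A) (tabulate-cong λ j → cong (dot b) (column-suc j A)) ⟩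
  dot b (map head A) * y + dot (tabulate (λ j → dot b (column j (map tail A)))) v
    ≡⟨ cong (dot b (map head A) * y +_) (dot-tabulate-column b (map tail A) v) ⟩
  dot b (map head A) * y + dot b (apply (map tail A) v)
    ≡⟨ sym (dot-axpy b (map head A) (apply (map tail A) v) y) ⟩
  dot b (axpy y (map head A) (apply (map tail A) v))
    ≡⟨ cong (dot b) (sym (apply-∷ A y v)) ⟩
  dot b (apply A (y ∷ v)) ∎

apply-· : ∀ {m k n} (B : Mat m k) (A : Mat k n) v → apply (B · A) v ≡ apply B (apply A v)
apply-· B A v = map-∘-cong (λ b → dot-tabulate-column b A v) B

apply-⊗ : ∀ {m₁ n₁ m₂ n₂} (A : Mat m₁ n₁) (B : Mat m₂ n₂) u w →
  apply (A ⊗ B) (u ++ w) ≡ apply A u ++ apply B w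
apply-⊗ {n₁ = n₁} {n₂ = n₂} A B u w = begin
  apply (A ⊗ B) (u ++ w)
    ≡⟨ map-++ (λ r → dot r (u ++ w)) (map (_++ replicate n₂ 0) A) (map (replicate n₁ 0 ++_) B) ⟩
  map (λ r → dot r (u ++ w)) (map (_++ replicate n₂ 0) A) ++
  map (λ r → dot r (u ++ w)) (map (replicate n₁ 0 ++_) B)
    ≡⟨ cong₂ _++_ (map-∘-cong upper A) (map-∘-cong lower B) ⟩
  apply A u ++ apply B w ∎
  where
  upper : ∀ r → dot (r ++ replicate n₂ 0) (u ++ w) ≡ dot r u
  upper r = trans (dot-++ r u _ w) (trans (cong (dot r u +_) (dot-zeroˡ w)) (+-identityʳ _))
  lower : ∀ r → dot (replicate n₁ 0 ++ r) (u ++ w) ≡ dot r w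
  lower r = trans (dot-++ (replicate n₁ 0) u r w) (cong (_+ dot r w) (dot-zeroˡ u))

dot-injective : ∀ {n} (r s : Vec ℕ n) → (∀ v → dot r v ≡ dot s v) → r ≡ s
dot-injective [] [] _ = refl
dot-injective {suc n} (x ∷ r) (y ∷ s) r≗s =
  cong₂ _∷_ (trans (sym (at-unit x r)) (trans (r≗s (1 ∷ replicate n 0)) (at-unit y s)))
            (dot-injective r s λ v → trans (sym (at-0∷ x r v)) (trans (r≗s (0 ∷ v)) (at-0∷ y s v)))
  where
  at-unit : ∀ x r → dot (x ∷ r) (1 ∷ replicate n 0) ≡ x
  at-unit x r = trans (cong₂ _+_ (*-identityʳ x) (dot-zeroʳ r)) (+-identityʳ x)
  at-0∷ : ∀ x r v → dot (x ∷ r) (0 ∷ v) ≡ dot r v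
  at-0∷ x r v = cong (_+ dot r v) (*-zeroʳ x)

apply-injective : ∀ {m n} {A B : Mat m n} → apply A ≗ apply B → A ≡ B
apply-injective {A = []} {[]} _ = refl
apply-injective {A = r ∷ A} {s ∷ B} A≗B =
  cong₂ _∷_ (dot-injective r s (∷-injectiveˡ ∘ A≗B)) (apply-injective (∷-injectiveʳ ∘ A≗B))

-- Thinnings and submatrices

data Thinning : ℕ → ℕ → Set where
  done : Thinning 0 0
  keep : ∀ {a m} → Thinning a m → Thinning (suc a) (suc m)
  skip : ∀ {a m} → Thinning a m → Thinning a (suc m)

select : ∀ {A : Set} {a m} → Thinning a m → Vec A m → Vec A a
select done [] = []
select (keep θ) (x ∷ v) = x ∷ select θ v
select (skip θ) (x ∷ v) = select θ v

pad : ∀ {a m} → Thinning a m → Vec ℕ a → Vec ℕ m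
pad done [] = []
pad (keep θ) (x ∷ v) = x ∷ pad θ v
pad (skip θ) v = 0 ∷ pad θ v

keepAll : ∀ n → Thinning n n
keepAll zero = done
keepAll (suc n) = keep (keepAll n)

skipAll : ∀ n → Thinning 0 n
skipAll zero = done
skipAll (suc n) = skip (skipAll n)

infixr 5 _++ᵗ_
_++ᵗ_ : ∀ {a₁ m₁ a₂ m₂} → Thinning a₁ m₁ → Thinning a₂ m₂ →
  Thinning (a₁ + a₂) (m₁ + m₂)
done ++ᵗ ψ = ψ
keep θ ++ᵗ ψ = keep (θ ++ᵗ ψ)
skip θ ++ᵗ ψ = skip (θ ++ᵗ ψ)

-- Not θ ++ᵗ skipAll m₂, whose index a + 0 is not definitionally a.
widen : ∀ {a m₁} → Thinning a m₁ → ∀ m₂ → Thinning a (m₁ + m₂)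
widen done m₂ = skipAll m₂
widen (keep θ) m₂ = keep (widen θ m₂)
widen (skip θ) m₂ = skip (widen θ m₂)

select-keepAll : ∀ {A : Set} {n} (v : Vec A n) → select (keepAll n) v ≡ v
select-keepAll [] = refl
select-keepAll (x ∷ v) = cong (x ∷_) (select-keepAll v)

pad-keepAll : ∀ {n} (v : Vec ℕ n) → pad (keepAll n) v ≡ v
pad-keepAll [] = refl
pad-keepAll (x ∷ v) = cong (x ∷_) (pad-keepAll v)

select-++ᵗ : ∀ {A : Set} {a₁ m₁ a₂ m₂} (θ₁ : Thinning a₁ m₁) (θ₂ : Thinning a₂ m₂)
  (u : Vec A m₁) w →
  select (θ₁ ++ᵗ θ₂) (u ++ w) ≡ select θ₁ u ++ select θ₂ w
select-++ᵗ done θ₂ [] w = refl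
select-++ᵗ (keep θ₁) θ₂ (x ∷ u) w = cong (x ∷_) (select-++ᵗ θ₁ θ₂ u w)
select-++ᵗ (skip θ₁) θ₂ (x ∷ u) w = select-++ᵗ θ₁ θ₂ u w

select-skipAll : ∀ {A : Set} {n} (v : Vec A n) → select (skipAll n) v ≡ []
select-skipAll [] = refl
select-skipAll (x ∷ v) = select-skipAll v

select-widen : ∀ {A : Set} {a m₁ m₂} (θ : Thinning a m₁) (u : Vec A m₁) (w : Vec A m₂) →
  select (widen θ m₂) (u ++ w) ≡ select θ u
select-widen done [] w = select-skipAll w
select-widen (keep θ) (x ∷ u) w = cong (x ∷_) (select-widen θ u w)
select-widen (skip θ) (x ∷ u) w = select-widen θ u w

select-replicate : ∀ {A : Set} {a m} (θ : Thinning a m) (x : A) →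
  select θ (replicate m x) ≡ replicate a x
select-replicate done x = refl
select-replicate (keep θ) x = cong (x ∷_) (select-replicate θ x)
select-replicate (skip θ) x = select-replicate θ x

select-map : ∀ {A B : Set} {a m} (θ : Thinning a m) (f : A → B) (v : Vec A m) →
  select θ (map f v) ≡ map f (select θ v)
select-map done f [] = refl
select-map (keep θ) f (x ∷ v) = cong (f x ∷_) (select-map θ f v)
select-map (skip θ) f (x ∷ v) = select-map θ f v

dot-select : ∀ {a m} (θ : Thinning a m) (r : Vec ℕ m) v → dot (select θ r) v ≡ dot r (pad θ v)
dot-select done [] [] = refl
dot-select (keep θ) (x ∷ r) (y ∷ v) = cong (x * y +_) (dot-select θ r v)
dot-select (skip θ) (x ∷ r) v =
  trans (dot-select θ r v) (cong (_+ dot r (pad θ v)) (sym (*-zeroʳ x)))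

submatrix : ∀ {a b m n} → Thinning a m → Thinning b n → Mat m n → Mat a b
submatrix θ φ F = select θ (map (select φ) F)

apply-submatrix : ∀ {a b m n} (θ : Thinning a m) (φ : Thinning b n) (F : Mat m n) v →
  apply (submatrix θ φ F) v ≡ select θ (apply F (pad φ v))
apply-submatrix θ φ F v = begin
  map (λ r → dot r v) (select θ (map (select φ) F))
    ≡⟨ sym (select-map θ _ _) ⟩
  select θ (map (λ r → dot r v) (map (select φ) F))
    ≡⟨ cong (select θ) (map-∘-cong (λ r → dot-select φ r v) F) ⟩
  select θ (apply F (pad φ v)) ∎

submatrix-keepAll : ∀ {m n} (F : Mat m n) → submatrix (keepAll m) (keepAll n) F ≡ F
submatrix-keepAll F =
  trans (select-keepAll _) (trans (map-cong select-keepAll F) (map-id F))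

submatrix-· : ∀ {a b m j n} (θ : Thinning a m) (φ : Thinning b n) (C : Mat m j) (B : Mat j n) →
  submatrix θ φ (C · B) ≡ submatrix θ (keepAll j) C · submatrix (keepAll j) φ B
submatrix-· {j = j} θ φ C B = apply-injective λ v → begin
  apply (submatrix θ φ (C · B)) v
    ≡⟨ apply-submatrix θ φ (C · B) v ⟩
  select θ (apply (C · B) (pad φ v))
    ≡⟨ cong (select θ) (apply-· C B (pad φ v)) ⟩
  select θ (apply C (apply B (pad φ v)))
    ≡⟨ cong (select θ ∘ apply C) (sym (trans (pad-keepAll _) (select-keepAll _))) ⟩
  select θ (apply C (pad (keepAll j) (select (keepAll j) (apply B (pad φ v)))))
    ≡⟨ sym (apply-submatrix θ (keepAll j) C _) ⟩
  apply (submatrix θ (keepAll j) C) (select (keepAll j) (apply B (pad φ v)))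
    ≡⟨ cong (apply (submatrix θ (keepAll j) C)) (sym (apply-submatrix (keepAll j) φ B v)) ⟩
  apply (submatrix θ (keepAll j) C) (apply (submatrix (keepAll j) φ B) v)
    ≡⟨ sym (apply-· _ _ v) ⟩
  apply (submatrix θ (keepAll j) C · submatrix (keepAll j) φ B) v ∎

select-⊗ : ∀ {a₁ m₁ a₂ m₂ n₁ n₂} (θ₁ : Thinning a₁ m₁) (θ₂ : Thinning a₂ m₂)
  (X₁ : Mat m₁ n₁) (X₂ : Mat m₂ n₂) →
  select (θ₁ ++ᵗ θ₂) (X₁ ⊗ X₂) ≡ select θ₁ X₁ ⊗ select θ₂ X₂
select-⊗ {n₁ = n₁} {n₂} θ₁ θ₂ X₁ X₂ =
  trans (select-++ᵗ θ₁ θ₂ _ _)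
        (cong₂ _++_ (select-map θ₁ (_++ replicate n₂ 0) X₁)
                    (select-map θ₂ (replicate n₁ 0 ++_) X₂))

map-select-⊗ : ∀ {b₁ n₁ b₂ n₂ m₁ m₂} (φ₁ : Thinning b₁ n₁) (φ₂ : Thinning b₂ n₂)
  (X₁ : Mat m₁ n₁) (X₂ : Mat m₂ n₂) →
  map (select (φ₁ ++ᵗ φ₂)) (X₁ ⊗ X₂) ≡ map (select φ₁) X₁ ⊗ map (select φ₂) X₂
map-select-⊗ {n₁ = n₁} {n₂ = n₂} φ₁ φ₂ X₁ X₂ = begin
  map (select φ) (map (_++ replicate n₂ 0) X₁ ++ map (replicate n₁ 0 ++_) X₂)
    ≡⟨ map-++ (select φ) (map (_++ replicate n₂ 0) X₁) _ ⟩
  map (select φ) (map (_++ replicate n₂ 0) X₁) ++ map (select φ) (map (replicate n₁ 0 ++_) X₂)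
    ≡⟨ cong₂ _++_ (trans (map-∘-cong upper X₁) (map-∘ _ _ X₁))
                  (trans (map-∘-cong lower X₂) (map-∘ _ _ X₂)) ⟩
  map (select φ₁) X₁ ⊗ map (select φ₂) X₂ ∎
  where
  φ = φ₁ ++ᵗ φ₂
  upper : ∀ r → select φ (r ++ replicate n₂ 0) ≡ select φ₁ r ++ replicate _ 0
  upper r = trans (select-++ᵗ φ₁ φ₂ r _) (cong (select φ₁ r ++_) (select-replicate φ₂ 0))
  lower : ∀ r → select φ (replicate n₁ 0 ++ r) ≡ replicate _ 0 ++ select φ₂ r
  lower r = trans (select-++ᵗ φ₁ φ₂ _ r) (cong (_++ select φ₂ r) (select-replicate φ₁ 0))

submatrix-⊗ : ∀ {a₁ m₁ a₂ m₂ b₁ n₁ b₂ n₂}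
  (θ₁ : Thinning a₁ m₁) (θ₂ : Thinning a₂ m₂) (φ₁ : Thinning b₁ n₁) (φ₂ : Thinning b₂ n₂)
  (F₁ : Mat m₁ n₁) (F₂ : Mat m₂ n₂) →
  submatrix (θ₁ ++ᵗ θ₂) (φ₁ ++ᵗ φ₂) (F₁ ⊗ F₂) ≡
  submatrix θ₁ φ₁ F₁ ⊗ submatrix θ₂ φ₂ F₂
submatrix-⊗ θ₁ θ₂ φ₁ φ₂ F₁ F₂ =
  trans (cong (select (θ₁ ++ᵗ θ₂)) (map-select-⊗ φ₁ φ₂ F₁ F₂)) (select-⊗ θ₁ θ₂ _ _)

submatrix-widen : ∀ {a m₁ m₂ b n₁ n₂} (θ : Thinning a m₁) (φ : Thinning b n₁)
  (F₁ : Mat m₁ n₁) (F₂ : Mat m₂ n₂) →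
  submatrix (widen θ m₂) (widen φ n₂) (F₁ ⊗ F₂) ≡ submatrix θ φ F₁
submatrix-widen {m₂ = m₂} {n₂ = n₂} θ φ F₁ F₂ = begin
  select (widen θ m₂) (map (select (widen φ n₂)) (map (_++ replicate n₂ 0) F₁ ++ _))
    ≡⟨ cong (select (widen θ m₂))
            (map-++ (select (widen φ n₂)) (map (_++ replicate n₂ 0) F₁) _) ⟩
  select (widen θ m₂) (map (select (widen φ n₂)) (map (_++ replicate n₂ 0) F₁) ++ _)
    ≡⟨ select-widen θ _ _ ⟩
  select θ (map (select (widen φ n₂)) (map (_++ replicate n₂ 0) F₁))
    ≡⟨ cong (select θ) (map-∘-cong (λ r → select-widen φ r _) F₁) ⟩
  select θ (map (select φ) F₁) ∎

-- Lower bound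

infix 4 _⊑_
_⊑_ : Mor → Mor → Set
g ⊑ f = Σ (Thinning (cod g) (cod f)) λ θ → Σ (Thinning (dom g) (dom f)) λ φ →
  mat g ≡ submatrix θ φ (mat f)

⊑-refl : ∀ f → f ⊑ f
⊑-refl f = keepAll (cod f) , keepAll (dom f) , sym (submatrix-keepAll (mat f))

⊑-⊗ˡ : ∀ {g f₁} f₂ → g ⊑ f₁ → g ⊑ f₁ ⊗ₘ f₂
⊑-⊗ˡ {f₁ = mor n₁ m₁ F₁} (mor n₂ m₂ F₂) (θ , φ , g≡) =
  widen θ m₂ , widen φ n₂ , trans g≡ (sym (submatrix-widen θ φ F₁ F₂))

⊑-⊗ʳ : ∀ {g} f₁ {f₂} → g ⊑ f₂ → g ⊑ f₁ ⊗ₘ f₂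
⊑-⊗ʳ (mor n₁ m₁ F₁) {mor n₂ m₂ F₂} (θ , φ , g≡) =
  skipAll m₁ ++ᵗ θ , skipAll n₁ ++ᵗ φ ,
  trans g≡ (sym (begin
    submatrix (skipAll m₁ ++ᵗ θ) (skipAll n₁ ++ᵗ φ) (F₁ ⊗ F₂)
      ≡⟨ submatrix-⊗ (skipAll m₁) θ (skipAll n₁) φ F₁ F₂ ⟩
    submatrix (skipAll m₁) (skipAll n₁) F₁ ⊗ submatrix θ φ F₂
      ≡⟨ cong (_⊗ submatrix θ φ F₂) (select-skipAll (map (select (skipAll n₁)) F₁)) ⟩
    [] ⊗ submatrix θ φ F₂
      ≡⟨ map-id _ ⟩
    submatrix θ φ F₂ ∎))

lookup-⊑-foldr₁ : ∀ {k} (fs : Vec Mor (suc k)) i → lookup fs i ⊑ foldr₁ _⊗ₘ_ fs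
lookup-⊑-foldr₁ (f ∷ []) fzero = ⊑-refl f
lookup-⊑-foldr₁ (f ∷ f′ ∷ fs) fzero = ⊑-⊗ˡ (foldr₁ _⊗ₘ_ (f′ ∷ fs)) (⊑-refl f)
lookup-⊑-foldr₁ (f ∷ f′ ∷ fs) (fsuc i) = ⊑-⊗ʳ f (lookup-⊑-foldr₁ (f′ ∷ fs) i)

_≟ₘ_ : DecidableEquality Mor
mor n m A ≟ₘ mor n′ m′ A′ with n ≟ n′ | m ≟ m′
... | no n≢n′ | _ = no (n≢n′ ∘ cong dom)
... | yes _ | no m≢m′ = no (m≢m′ ∘ cong cod)
... | yes refl | yes refl with ≡-dec (≡-dec _≟_) A A′
...   | yes refl = yes refl
...   | no A≢A′ = no λ { refl → A≢A′ refl }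

-- Decidability of equality turns ¬ Decomposable g, which only refutes that both factors
-- differ from g, into a choice of the factor equal to g.
indecomposable-⊗ : ∀ {g g₁ g₂} → ¬ Decomposable g → g ≡ g₁ ⊗ₘ g₂ →
  g ≡ g₁ ⊎ g ≡ g₂
indecomposable-⊗ {g} {g₁} {g₂} indecomposable g≡ with g₁ ≟ₘ g | g₂ ≟ₘ g
... | yes g₁≡g | _ = inj₁ (sym g₁≡g)
... | no _ | yes g₂≡g = inj₂ (sym g₂≡g)
... | no g₁≢g | no g₂≢g = ⊥-elim (indecomposable (g₁ , g₂ , g₁≢g , g₂≢g , g≡))

data Split (m₁ : ℕ) {m₂ : ℕ} : ∀ {a} → Thinning a (m₁ + m₂) → Set where
  split : ∀ {a₁ a₂} (θ₁ : Thinning a₁ m₁) (θ₂ : Thinning a₂ m₂) →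
          Split m₁ (θ₁ ++ᵗ θ₂)

split-at : ∀ m₁ {m₂ a} (θ : Thinning a (m₁ + m₂)) → Split m₁ θ
split-at zero θ = split done θ
split-at (suc m₁) (keep θ) with split-at m₁ θ
... | split θ₁ θ₂ = split (keep θ₁) θ₂
split-at (suc m₁) (skip θ) with split-at m₁ θ
... | split θ₁ θ₂ = split (skip θ₁) θ₂

⊑-⊗-indecomposable : ∀ {g} f₁ f₂ → g ⊑ f₁ ⊗ₘ f₂ → ¬ Decomposable g →
  g ⊑ f₁ ⊎ g ⊑ f₂
⊑-⊗-indecomposable {mor b a G} (mor n₁ m₁ F₁) (mor n₂ m₂ F₂) (θ , φ , G≡) indecomposable
  with split-at m₁ θ | split-at n₁ φ
... | split θ₁ θ₂ | split φ₁ φ₂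
  with indecomposable-⊗ indecomposable
         (cong (mor b a) (trans G≡ (submatrix-⊗ θ₁ θ₂ φ₁ φ₂ F₁ F₂)))
...   | inj₁ g≡g₁ = inj₁ (subst (_⊑ mor n₁ m₁ F₁) (sym g≡g₁) (θ₁ , φ₁ , refl))
...   | inj₂ g≡g₂ = inj₂ (subst (_⊑ mor n₂ m₂ F₂) (sym g≡g₂) (θ₂ , φ₂ , refl))

identityMatrix : ∀ n → Mat n n
identityMatrix zero = []
identityMatrix (suc n) = ((1 ∷ []) ∷ []) ⊗ identityMatrix n

apply-identityMatrix : ∀ {n} (v : Vec ℕ n) → apply (identityMatrix n) v ≡ v
apply-identityMatrix [] = refl
apply-identityMatrix (x ∷ v) =
  trans (apply-⊗ ((1 ∷ []) ∷ []) (identityMatrix _) (x ∷ []) v)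
        (cong₂ _∷_ (1*x+0≡x x) (apply-identityMatrix v))

·-identityʳ : ∀ {m n} (F : Mat m n) → F · identityMatrix n ≡ F
·-identityʳ F = apply-injective λ v → trans (apply-· F _ v) (cong (apply F) (apply-identityMatrix v))

⊑-·⇒factorsThrough : ∀ {g n j m} {C : Mat m j} {B : Mat j n} →
  g ⊑ mor n m (C · B) → FactorsThrough g j
⊑-·⇒factorsThrough {j = j} {C = C} {B} (θ , φ , g≡) =
  submatrix (keepAll j) φ B , submatrix θ (keepAll j) C , trans g≡ (submatrix-· θ φ C B)

⊑⇒factorsThrough-dom : ∀ {g} f → g ⊑ f → FactorsThrough g (dom f)
⊑⇒factorsThrough-dom {g} (mor n m F) g⊑f =
  ⊑-·⇒factorsThrough (subst (λ F′ → g ⊑ mor n m F′) (sym (·-identityʳ F)) g⊑f)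

indecomposable-⊑⇒factorsThrough≤wd : ∀ {n m F} (d : D n m F) {g} →
  g ⊑ mor n m F → ¬ Decomposable g → ∃[ k ] k ≤ wd d × FactorsThrough g k
indecomposable-⊑⇒factorsThrough≤wd (leaf {n} {m} {F} _) g⊑f _ =
  n , m≤m⊔n n m , ⊑⇒factorsThrough-dom (mor n m F) g⊑f
indecomposable-⊑⇒factorsThrough≤wd (seq {j = j} d₁ d₂) g⊑f _ =
  j , m≤n⇒m≤n⊔o (wd d₂) (m≤n⊔m (wd d₁) j) , ⊑-·⇒factorsThrough g⊑f
indecomposable-⊑⇒factorsThrough≤wd (tens d₁ d₂) g⊑f indecomposable
  with ⊑-⊗-indecomposable (mor _ _ _) (mor _ _ _) g⊑f indecomposable
... | inj₁ g⊑f₁ = map₂ (map₁ (m≤n⇒m≤n⊔o (wd d₂)))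
                     (indecomposable-⊑⇒factorsThrough≤wd d₁ g⊑f₁ indecomposable)
... | inj₂ g⊑f₂ = map₂ (map₁ (m≤n⇒m≤o⊔n (wd d₁)))
                     (indecomposable-⊑⇒factorsThrough≤wd d₂ g⊑f₂ indecomposable)

rank≤wd : ∀ {g f r} → ¬ Decomposable g → IsRank g r → g ⊑ f → (d : DMor f) → r ≤ wd d
rank≤wd indecomposable (_ , minimal) g⊑f d =
  let k , k≤ , factors = indecomposable-⊑⇒factorsThrough≤wd d g⊑f indecomposable
  in ≤-trans (minimal k factors) k≤

-- Upper bound

-- On an input of explicit shape, the specification of a composite realization computes to
-- its intended value, so most uses of respects below are discharged by refl.
record Realization (w : ℕ) {n m : ℕ} (f : Vec ℕ n → Vec ℕ m) : Set where
  field
    matrix : Mat m n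
    computes : apply matrix ≗ f
    decomposition : D n m matrix
    width≤ : wd decomposition ≤ w

open Realization

infixr 7 _∥_ _∥ᴿ_
infixl 6 _⨾⟨_⟩_

_∥_ : ∀ {n₁ m₁ n₂ m₂} → (Vec ℕ n₁ → Vec ℕ m₁) → (Vec ℕ n₂ → Vec ℕ m₂) →
  Vec ℕ (n₁ + n₂) → Vec ℕ (m₁ + m₂)
_∥_ {n₁} f g v = f (take n₁ v) ++ g (drop n₁ v)

apply-⊗-∥ : ∀ {m₁ n₁ m₂ n₂} (A : Mat m₁ n₁) (B : Mat m₂ n₂) →
  apply (A ⊗ B) ≗ (apply A ∥ apply B)
apply-⊗-∥ {n₁ = n₁} A B v =
  trans (cong (apply (A ⊗ B)) (sym (take++drop≡id n₁ v))) (apply-⊗ A B (take n₁ v) (drop n₁ v))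

atom : ∀ {n m F} {f : Vec ℕ n → Vec ℕ m} → Atom n m F → apply F ≗ f → Realization (n ⊔ m) f
atom g F≗f = record { matrix = _ ; computes = F≗f ; decomposition = leaf g ; width≤ = ≤-refl }

weaken : ∀ {w w′ n m} {f : Vec ℕ n → Vec ℕ m} →
  w ≤ w′ → Realization w f → Realization w′ f
weaken w≤w′ r = record
  { matrix = matrix r
  ; computes = computes r
  ; decomposition = decomposition r
  ; width≤ = ≤-trans (width≤ r) w≤w′
  }

respects : ∀ {w n m} {f g : Vec ℕ n → Vec ℕ m} → f ≗ g → Realization w f → Realization w g
respects f≗g r = record
  { matrix = matrix r
  ; computes = λ v → trans (computes r v) (f≗g v)
  ; decomposition = decomposition r
  ; width≤ = width≤ r
  }

_⨾⟨_⟩_ : ∀ {w n j m} {f : Vec ℕ n → Vec ℕ j} {g : Vec ℕ j → Vec ℕ m} →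
  Realization w f → j ≤ w → Realization w g → Realization w (g ∘ f)
r ⨾⟨ j≤w ⟩ s = record
  { matrix = matrix s · matrix r
  ; computes = λ v → trans (apply-· (matrix s) (matrix r) v)
                           (trans (cong (apply (matrix s)) (computes r v)) (computes s _))
  ; decomposition = seq (decomposition r) (decomposition s)
  ; width≤ = ⊔-lub (⊔-lub (width≤ r) j≤w) (width≤ s)
  }

_∥ᴿ_ : ∀ {w n₁ m₁ n₂ m₂}
  {f : Vec ℕ n₁ → Vec ℕ m₁} {g : Vec ℕ n₂ → Vec ℕ m₂} →
  Realization w f → Realization w g → Realization w (f ∥ g)
r ∥ᴿ s = record
  { matrix = matrix r ⊗ matrix s
  ; computes = λ v → trans (apply-⊗-∥ (matrix r) (matrix s) v)
                           (cong₂ _++_ (computes r _) (computes s _))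
  ; decomposition = tens (decomposition r) (decomposition s)
  ; width≤ = ⊔-lub (width≤ r) (width≤ s)
  }

realization⇒decomposition : ∀ {w n m} {A : Mat m n} →
  Realization w (apply A) → Σ (D n m A) λ d → wd d ≤ w
realization⇒decomposition r with apply-injective (computes r)
... | refl = decomposition r , width≤ r

identity₁ : Realization 1 (id {A = Vec ℕ 1})
identity₁ = atom id₁ λ { (x ∷ []) → cong (_∷ []) (1*x+0≡x x) }

copy : Realization 2 (λ (v : Vec ℕ 1) → v ++ v)
copy = atom cp₁ λ { (x ∷ []) → cong (λ y → y ∷ y ∷ []) (1*x+0≡x x) }

plus : Realization 2 λ { (x ∷ y ∷ []) → x + y ∷ [] }
plus = atom add₁ λ { (x ∷ y ∷ []) → cong (_∷ []) (cong₂ _+_ (*-identityˡ x) (1*x+0≡x y)) }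

swap : Realization 2 λ { (x ∷ y ∷ []) → y ∷ x ∷ [] }
swap = atom σ₁₁ λ { (x ∷ y ∷ []) → cong₂ (λ p q → p ∷ q ∷ []) (1*x+0≡x y) (1*x+0≡x x) }

constant-zero : Realization 1 (λ (_ : Vec ℕ 0) → 0 ∷ [])
constant-zero = atom zero₁ λ { [] → refl }

discard : Realization 1 (λ (_ : Vec ℕ 1) → [])
discard = atom del₁ λ _ → refl

identity : ∀ k → Realization 1 (id {A = Vec ℕ k})
identity zero = respects (λ { [] → refl }) (constant-zero ⨾⟨ ≤-refl ⟩ discard)
identity (suc k) = respects (λ { (x ∷ v) → refl }) (identity₁ ∥ᴿ identity k)

zeros : ∀ m → Realization 1 (λ (_ : Vec ℕ 0) → replicate m 0)
zeros zero = respects (λ { [] → refl }) (identity 0)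
zeros (suc m) = respects (λ { [] → refl }) (constant-zero ∥ᴿ zeros m)

discardAll : ∀ n → Realization 1 (λ (_ : Vec ℕ n) → [])
discardAll zero = respects (λ { [] → refl }) (identity 0)
discardAll (suc n) = discard ∥ᴿ discardAll n

scale : ∀ c → Realization 2 (map (c *_))
scale zero = respects (λ { (x ∷ []) → refl }) (weaken z<s (discard ⨾⟨ z≤n ⟩ constant-zero))
scale (suc c) = respects (λ { (x ∷ []) → refl })
  (copy ⨾⟨ ≤-refl ⟩ weaken z<s identity₁ ∥ᴿ scale c ⨾⟨ ≤-refl ⟩ plus)

shear : ∀ c → Realization 3 λ { (x ∷ y ∷ []) → x ∷ c * x + y ∷ [] }
shear c = respects (λ { (x ∷ y ∷ []) → refl })
  (  weaken (m≤m+n 2 1) copy ∥ᴿ weaken z<s identity₁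
  ⨾⟨ ≤-refl ⟩ weaken z<s identity₁ ∥ᴿ weaken (m≤m+n 2 1) (scale c) ∥ᴿ weaken z<s identity₁
  ⨾⟨ ≤-refl ⟩ weaken z<s identity₁ ∥ᴿ weaken (m≤m+n 2 1) plus)

-- shear has width 3, so vectors of length one (where the bound is 2) need a case of their
-- own here and in dot-realization.
axpy-realization : ∀ {m} (a : Vec ℕ m) → Realization (suc m) (λ v → axpy (head v) a (tail v))
axpy-realization [] = respects (λ { (x ∷ []) → refl }) discard
axpy-realization (c ∷ []) = respects (λ { (x ∷ y ∷ []) → refl })
  (scale c ∥ᴿ weaken z<s identity₁ ⨾⟨ ≤-refl ⟩ plus)
axpy-realization {suc (suc l)} (c ∷ c′ ∷ a) = respects (λ { (x ∷ y ∷ ys) → refl })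
  (  weaken (m≤m+n 3 l) (shear c) ∥ᴿ weaken z<s (identity (suc l))
  ⨾⟨ ≤-refl ⟩ weaken (m≤m+n 2 (suc l)) swap ∥ᴿ weaken z<s (identity (suc l))
  ⨾⟨ ≤-refl ⟩ weaken z<s identity₁ ∥ᴿ weaken (n≤1+n _) (axpy-realization (c′ ∷ a)))

dot-realization : ∀ {n} (r : Vec ℕ n) → Realization (suc n) (λ v → dot r v ∷ v)
dot-realization [] = respects (λ { [] → refl }) constant-zero
dot-realization (c ∷ []) =
  respects (λ { (y ∷ []) → cong (λ t → t ∷ y ∷ []) (sym (+-identityʳ (c * y))) })
  (copy ⨾⟨ ≤-refl ⟩ scale c ∥ᴿ weaken z<s identity₁)
dot-realization {suc (suc l)} (c ∷ c′ ∷ r) = respects (λ { (y ∷ ys) → refl })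
  (  weaken z<s identity₁ ∥ᴿ weaken (n≤1+n _) (dot-realization (c′ ∷ r))
  ⨾⟨ ≤-refl ⟩ weaken (m≤m+n 3 l) (shear c) ∥ᴿ weaken z<s (identity (suc l))
  ⨾⟨ ≤-refl ⟩ weaken (m≤m+n 2 (suc l)) swap ∥ᴿ weaken z<s (identity (suc l)))

realize-by-columns : ∀ {m n} (A : Mat m n) → Realization (suc m) (apply A)
realize-by-columns {m} {zero} A =
  respects (λ { [] → sym (apply-[] A) }) (weaken z<s (zeros m))
realize-by-columns {m} {suc n} A = respects (λ { (x ∷ v) → sym (apply-∷ A x v) })
  (  weaken z<s identity₁ ∥ᴿ realize-by-columns (map tail A)
  ⨾⟨ ≤-refl ⟩ axpy-realization (map head A))

realize-by-rows : ∀ {m n} (A : Mat m n) → Realization (suc n) (apply A)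
realize-by-rows {n = n} [] = weaken z<s (discardAll n)
realize-by-rows (r ∷ A) =
  dot-realization r ⨾⟨ ≤-refl ⟩ weaken z<s identity₁ ∥ᴿ realize-by-rows A

factorsThrough⇒decomposition : ∀ {f r} → FactorsThrough f r → Σ (DMor f) λ d → wd d ≤ suc r
factorsThrough⇒decomposition {mor n m F} {r} (B , C , F≡C·B) =
  realization⇒decomposition
    (respects C·B≗F (realize-by-columns B ⨾⟨ n≤1+n r ⟩ realize-by-rows C))
  where
  C·B≗F : ∀ v → apply C (apply B v) ≡ apply F v
  C·B≗F v = trans (sym (apply-· C B v)) (cong (λ M → apply M v) (sym F≡C·B))

foldr₁-⊗ₘ-decomposition : ∀ {k} (fs : Vec Mor (suc k)) (rs : Vec ℕ (suc k)) →
  (∀ i → FactorsThrough (lookup fs i) (lookup rs i)) →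
  Σ (DMor (foldr₁ _⊗ₘ_ fs)) λ d → wd d ≤ suc (foldr₁ _⊔_ rs)
foldr₁-⊗ₘ-decomposition (f ∷ []) (r ∷ []) factors = factorsThrough⇒decomposition (factors fzero)
foldr₁-⊗ₘ-decomposition (f ∷ f′ ∷ fs) (r ∷ r′ ∷ rs) factors =
  let d₁ , d₁≤ = factorsThrough⇒decomposition (factors fzero)
      d₂ , d₂≤ = foldr₁-⊗ₘ-decomposition (f′ ∷ fs) (r′ ∷ rs) (factors ∘ fsuc)
  in tens d₁ d₂ , ⊔-mono-≤ d₁≤ d₂≤

foldr₁-⊔-lub : ∀ {k x} (rs : Vec ℕ (suc k)) →
  (∀ i → lookup rs i ≤ x) → foldr₁ _⊔_ rs ≤ x
foldr₁-⊔-lub (r ∷ []) bounded = bounded fzero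
foldr₁-⊔-lub (r ∷ r′ ∷ rs) bounded =
  ⊔-lub (bounded fzero) (foldr₁-⊔-lub (r′ ∷ rs) (bounded ∘ fsuc))

theorem4p13 : (f : Mor) (k : ℕ) (fs : Vec Mor (suc k)) (rs : Vec ℕ (suc k)) →
    foldr₁ _⊗ₘ_ fs ≡ f →
    (∀ i → ¬ Decomposable (lookup fs i)) →
    (∀ i → IsRank (lookup fs i) (lookup rs i)) →
    ((d : DMor f) → foldr₁ _⊔_ rs ≤ wd d)
    × Σ (DMor f) (λ d → wd d ≤ suc (foldr₁ _⊔_ rs))
theorem4p13 .(foldr₁ _⊗ₘ_ fs) k fs rs refl indecomposable rank =
  (λ d → foldr₁-⊔-lub rs λ i → rank≤wd (indecomposable i) (rank i) (lookup-⊑-foldr₁ fs i) d) ,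
  foldr₁-⊗ₘ-decomposition fs rs (λ i → proj₁ (rank i))
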